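{- Let $P=([n],\preceq)$ be a poset and $0\le r\le n$, and assume $P=\widetilde P^r$ (so that $\lambda=n-r$). Then (a) for each $a\in[n]$, $|[n]\setminus{<}\{a\}{>}|\ge\lambda$; (b) if there exists an $r$-perfect $P$-code $\mathcal{C}\subseteq F^n$ with $|\mathcal{C}|=2^{n-m}$, then for all $a,a'\in[n]$, $|[n]\setminus{<}\{a,a'\}{>}|\ge r+\lambda-m$; (c) for each $b\in[n]$, $|{>}\{b\}{<}|\le\lambda$.
   Context: $[n]=\{1,\dots,n\}$; subsets of $[n]$ are identified with their characteristic vectors in $F^n=\{0,1\}^n$, and $x+y$ is the symmetric difference. An ideal of $P$ is a set $I\subseteq[n]$ such that $a\in I$ and $b\preceq a$ imply $b\in I$; ${<}X{>}$ is the smallest ideal containing $X$ and ${>}X{<}$ the smallest upset (set closed under going up) containing $X$. $\mathcal{I}_P^r$ is the set of ideals of cardinality $r$; $P^r=\bigcup_{J\in\mathcal{I}_P^r}J$, $\widetilde P^r=P^r\setminus\bigcap_{J\in\mathcal{I}_P^r}J$, and $\lambda=|P^r|-r$. The $P$-weight is $w_P(x)=|{<}x{>}|$ and $\mathcal{B}_P^r=\{x\in F^n: w_P(x)\le r\}$. A $P$-code $\mathcal{C}\subseteq F^n$ is $r$-perfect if every $x\in F^n$ has exactly one representation $x=c+b$ with $c\in\mathcal{C}$, $b\in\mathcal{B}_P^r$. -}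

module Defs where

open import Level using (0ℓ)
open import Data.Bool using (Bool; _xor_; true; false)
open import Data.Nat using (ℕ; _≤_)
open import Data.Fin using (Fin)
open import Data.Fin.Subset using (Subset; _∈_; _∉_; ∣_∣)
open import Data.Fin.Subset.Properties using (_∈?_)
open import Data.Fin.Properties using (any?)
open import Data.Vec using (Vec; tabulate; zipWith)
open import Data.Product using (Σ; ∃; _×_; _,_)
open import Data.List using (List)
open import Data.List.Membership.Propositional using () renaming (_∈_ to _∈ₗ_)
open import Relation.Nullary using (does; _×-dec_)
open import Relation.Binary using (Rel; Decidable; IsDecPartialOrder)
open import Relation.Binary.PropositionalEquality using (_≡_)

_⊕_ : ∀ {n} → Vec Bool n → Vec Bool n → Vec Bool n
_⊕_ = zipWith _xor_

module _ {n : ℕ} {_≼_ : Rel (Fin n) 0ℓ} (≼? : Decidable _≼_) where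

  ⟨_⟩ : Subset n → Subset n
  ⟨ X ⟩ = tabulate (λ i → does (any? (λ j → (j ∈? X) ×-dec (≼? i j))))

  ⟩_⟨ : Subset n → Subset n
  ⟩ X ⟨ = tabulate (λ i → does (any? (λ j → (j ∈? X) ×-dec (≼? j i))))

  wP : Vec Bool n → ℕ
  wP x = ∣ ⟨ x ⟩ ∣

  InBall : ℕ → Vec Bool n → Set
  InBall r x = wP x ≤ r

  IsPerfect : ℕ → List (Vec Bool n) → Set
  IsPerfect r C = ∀ x →
      (Σ (Vec Bool n) λ c → Σ (Vec Bool n) λ b → c ∈ₗ C × InBall r b × x ≡ c ⊕ b)
    × (∀ c b c' b' → c ∈ₗ C → InBall r b → x ≡ c ⊕ b
                   → c' ∈ₗ C → InBall r b' → x ≡ c' ⊕ b' → c ≡ c' × b ≡ b')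

IsIdeal : ∀ {n} → Rel (Fin n) 0ℓ → Subset n → Set
IsIdeal _≼_ I = ∀ a b → a ∈ I → b ≼ a → b ∈ I

-- P = P̃^r : every a lies in some ideal of size r (a ∈ P^r) and outside
-- some ideal of size r (a ∉ ⋂ of all ideals of size r).
FullTilde : ∀ {n} → Rel (Fin n) 0ℓ → ℕ → Set
FullTilde {n} _≼_ r = ∀ (a : Fin n) →
    (∃ λ J → IsIdeal _≼_ J × ∣ J ∣ ≡ r × a ∈ J)
  × (∃ λ J → IsIdeal _≼_ J × ∣ J ∣ ≡ r × a ∉ J)

-- A codeword is determined by its coordinates outside I = ⟨{a, a'}⟩: two codewords
-- agreeing there differ by a vector supported on ⟨a⟩ ∪ ⟨a'⟩, which splits as a sum of two
-- vectors of P-weight ≤ r (each of ⟨a⟩, ⟨a'⟩ lies in an ideal of size r), and perfection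
-- forbids two distinct codewords at such a distance. Hence 2^(n-m) = |C| ≤ 2^|[n] ∖ I|.
-- Parts (a) and (c) compare ⟨a⟩ with an ideal of size r containing a, and >b< with the
-- complement of an ideal of size r avoiding b.
module Submission where

open import Defs
open import Level using (0ℓ)
open import Data.Bool using (Bool; true; false; not; _∧_; _xor_)
open import Data.Nat using (ℕ; _≤_; _≥_; _+_; _∸_; _*_; _^_; z≤n; s≤s; suc)
open import Data.Nat.Properties
  using (+-comm; +-identityʳ; *-monoˡ-≤; ^-distribˡ-+-*; ^-monoʳ-<; <⇒≱; ≮⇒≥;
         m≤n+o⇒m∸n≤o; m+[n∸m]≡n; ∸-monoʳ-≤)
open import Data.Fin using (Fin)
open import Data.Fin.Subset using (Subset; ∣_∣; ∁; ⁅_⁆; _∪_; _∩_; _⊆_) renaming (_∈_ to _∈ₛ_; _∉_ to _∉ₛ_)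
open import Data.Fin.Subset.Properties
  using (p⊆q⇒∣p∣≤∣q∣; ∣∁p∣≡n∸∣p∣; x∈⁅y⁆⇒x≡y; x∉p⇒x∈∁p; x∈∁p⇒x∉p;
         x∈p∪q⁺; x∈p∪q⁻; x∈p∩q⁻; p∩q⊆q; drop-∷-⊆; _∈?_)
open import Data.Fin.Properties using (any?)
open import Data.Vec using (Vec; []; _∷_; tabulate; here; there)
open import Data.Vec.Properties using (lookup∘tabulate; []=⇒lookup; lookup⇒[]=; ∷-injectiveʳ)
open import Data.List using (List; length; []; _∷_; map; _++_)
open import Data.List.Properties using (length-map; length-++; length-++-sucʳ)
open import Data.List.Relation.Unary.Unique.Propositional using (Unique)
open import Data.List.Relation.Unary.AllPairs using (_∷_)
open import Data.List.Relation.Unary.All using () renaming (lookup to All-lookup)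
open import Data.List.Relation.Unary.Any using () renaming (here to hereₗ; there to thereₗ)
open import Data.List.Membership.Propositional using () renaming (_∈_ to _∈ₗ_)
open import Data.List.Membership.Propositional.Properties using (∈-map⁺; ∈-++⁺ˡ; ∈-++⁺ʳ; ∈-++⁻; ∈-∃++)
open import Data.Product using (_×_; _,_; ∃; proj₁; proj₂)
open import Data.Sum using (inj₁; inj₂)
open import Data.Empty using (⊥-elim)
open import Function using (_∘_)
open import Relation.Nullary using (yes; no; does; _×-dec_)
open import Relation.Nullary.Decidable using (dec-true)
open import Relation.Unary as U using (Pred)
open import Relation.Binary using (Rel; Decidable; IsDecPartialOrder)
open import Relation.Binary.PropositionalEquality using (_≡_; _≢_; refl; sym; trans; cong; cong₂; subst; module ≡-Reasoning)

∈-++-∷⁻ : ∀ {A : Set} {x y : A} xs ys → x ∈ₗ xs ++ y ∷ ys → x ≢ y → x ∈ₗ xs ++ ys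
∈-++-∷⁻ xs ys x∈ x≢y with ∈-++⁻ xs x∈
... | inj₁ x∈xs           = ∈-++⁺ˡ x∈xs
... | inj₂ (hereₗ x≡y)    = ⊥-elim (x≢y x≡y)
... | inj₂ (thereₗ x∈ys)  = ∈-++⁺ʳ xs x∈ys

length-≤-injectiveOn : ∀ {A B : Set} (f : A → B) {xs : List A} {ys : List B} → Unique xs →
  (∀ {x y} → x ∈ₗ xs → y ∈ₗ xs → f x ≡ f y → x ≡ y) →
  (∀ {x} → x ∈ₗ xs → f x ∈ₗ ys) → length xs ≤ length ys
length-≤-injectiveOn f {[]} _ _ _ = z≤n
length-≤-injectiveOn f {x ∷ xs} {ys} (x∉xs ∷ xs!) inj maps
  with ys₁ , ys₂ , refl ← ∈-∃++ (maps (hereₗ refl)) =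
  subst (suc (length xs) ≤_) (sym (length-++-sucʳ ys₁ (f x) ys₂))
    (s≤s (length-≤-injectiveOn f xs! (λ p q → inj (thereₗ p) (thereₗ q)) maps′))
  where
  maps′ : ∀ {y} → y ∈ₗ xs → f y ∈ₗ ys₁ ++ ys₂
  maps′ y∈xs = ∈-++-∷⁻ ys₁ ys₂ (maps (thereₗ y∈xs))
    (λ fy≡fx → All-lookup x∉xs y∈xs (sym (inj (thereₗ y∈xs) (hereₗ refl) fy≡fx)))

subsets : ∀ {n} → Subset n → List (Subset n)
subsets []          = [] ∷ []
subsets (false ∷ S) = map (false ∷_) (subsets S)
subsets (true ∷ S)  = map (false ∷_) (subsets S) ++ map (true ∷_) (subsets S)

length-subsets : ∀ {n} (S : Subset n) → length (subsets S) ≡ 2 ^ ∣ S ∣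
length-subsets []          = refl
length-subsets (false ∷ S) = trans (length-map (false ∷_) (subsets S)) (length-subsets S)
length-subsets (true ∷ S)  = begin
  length (map (false ∷_) (subsets S) ++ map (true ∷_) (subsets S))
    ≡⟨ length-++ (map (false ∷_) (subsets S)) ⟩
  length (map (false ∷_) (subsets S)) + length (map (true ∷_) (subsets S))
    ≡⟨ cong₂ _+_ (length-map (false ∷_) (subsets S)) (length-map (true ∷_) (subsets S)) ⟩
  length (subsets S) + length (subsets S)
    ≡⟨ cong (λ k → k + k) (length-subsets S) ⟩
  2 ^ ∣ S ∣ + 2 ^ ∣ S ∣
    ≡⟨ cong (2 ^ ∣ S ∣ +_) (sym (+-identityʳ (2 ^ ∣ S ∣))) ⟩
  2 ^ suc ∣ S ∣ ∎
  where open ≡-Reasoning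

⊆⇒∈-subsets : ∀ {n} (S X : Subset n) → X ⊆ S → X ∈ₗ subsets S
⊆⇒∈-subsets []          []          _   = hereₗ refl
⊆⇒∈-subsets (false ∷ S) (false ∷ X) X⊆S = ∈-map⁺ (false ∷_) (⊆⇒∈-subsets S X (drop-∷-⊆ X⊆S))
⊆⇒∈-subsets (false ∷ S) (true ∷ X)  X⊆S with () ← X⊆S here
⊆⇒∈-subsets (true ∷ S)  (false ∷ X) X⊆S =
  ∈-++⁺ˡ (∈-map⁺ (false ∷_) (⊆⇒∈-subsets S X (drop-∷-⊆ X⊆S)))
⊆⇒∈-subsets (true ∷ S)  (true ∷ X)  X⊆S =
  ∈-++⁺ʳ (map (false ∷_) (subsets S)) (∈-map⁺ (true ∷_) (⊆⇒∈-subsets S X (drop-∷-⊆ X⊆S)))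

length-≤-2^-if-determinedOn : ∀ {n} (S : Subset n) {C : List (Subset n)} → Unique C →
  (∀ {c c'} → c ∈ₗ C → c' ∈ₗ C → c ∩ S ≡ c' ∩ S → c ≡ c') → length C ≤ 2 ^ ∣ S ∣
length-≤-2^-if-determinedOn S {C} C! determined = subst (length C ≤_) (length-subsets S)
  (length-≤-injectiveOn (_∩ S) C! determined (λ {c} _ → ⊆⇒∈-subsets S (c ∩ S) (p∩q⊆q c S)))

*2^≡2^⇒∸≤ : ∀ {L} k m {n} → L ≤ 2 ^ k → L * 2 ^ m ≡ 2 ^ n → n ∸ m ≤ k
*2^≡2^⇒∸≤ {L} k m {n} L≤2^k L*2^m≡2^n = m≤n+o⇒m∸n≤o n m (subst (n ≤_) (+-comm k m) n≤k+m)
  where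
  open Data.Nat.Properties.≤-Reasoning
  2ⁿ≤2ᵏ⁺ᵐ : 2 ^ n ≤ 2 ^ (k + m)
  2ⁿ≤2ᵏ⁺ᵐ = begin
    2 ^ n         ≡⟨ sym L*2^m≡2^n ⟩
    L * 2 ^ m     ≤⟨ *-monoˡ-≤ (2 ^ m) L≤2^k ⟩
    2 ^ k * 2 ^ m ≡⟨ sym (^-distribˡ-+-* 2 k m) ⟩
    2 ^ (k + m)   ∎
  n≤k+m : n ≤ k + m
  n≤k+m = ≮⇒≥ λ k+m<n → <⇒≱ (^-monoʳ-< 2 (s≤s (s≤s z≤n)) k+m<n) 2ⁿ≤2ᵏ⁺ᵐ

xor-split : ∀ x y a → x xor ((x xor y) ∧ a) ≡ y xor ((x xor y) ∧ not a)
xor-split false false _     = refl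
xor-split true  true  _     = refl
xor-split false true  false = refl
xor-split false true  true  = refl
xor-split true  false false = refl
xor-split true  false true  = refl

⊕-split : ∀ {n} (c c' A : Vec Bool n) → c ⊕ ((c ⊕ c') ∩ A) ≡ c' ⊕ ((c ⊕ c') ∩ ∁ A)
⊕-split []       []         []       = refl
⊕-split (x ∷ c) (y ∷ c') (a ∷ A) = cong₂ _∷_ (xor-split x y a) (⊕-split c c' A)

∩∁-≡⇒⊕⊆ : ∀ {n} (c c' I : Subset n) → c ∩ ∁ I ≡ c' ∩ ∁ I → c ⊕ c' ⊆ I
∩∁-≡⇒⊕⊆ (_ ∷ c)     (_ ∷ c')     (_ ∷ I)     eq    (there k∈) = there (∩∁-≡⇒⊕⊆ c c' I (∷-injectiveʳ eq) k∈)
∩∁-≡⇒⊕⊆ (true ∷ _)  (false ∷ _)  (true ∷ _)  _     here       = here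
∩∁-≡⇒⊕⊆ (false ∷ _) (true ∷ _)   (true ∷ _)  _     here       = here
∩∁-≡⇒⊕⊆ (true ∷ _)  (false ∷ _)  (false ∷ _) ()    here
∩∁-≡⇒⊕⊆ (false ∷ _) (true ∷ _)   (false ∷ _) ()    here

∈-tabulate-does⁻ : ∀ {n} {P : Pred (Fin n) 0ℓ} (P? : U.Decidable P) {i} → i ∈ₛ tabulate (does ∘ P?) → P i
∈-tabulate-does⁻ P? {i} i∈ with P? i | trans (sym (lookup∘tabulate (does ∘ P?) i)) ([]=⇒lookup i∈)
... | yes p | _ = p
... | no _  | ()

∈-tabulate-does⁺ : ∀ {n} {P : Pred (Fin n) 0ℓ} (P? : U.Decidable P) {i} → P i → i ∈ₛ tabulate (does ∘ P?)
∈-tabulate-does⁺ P? {i} p = lookup⇒[]= i _ (trans (lookup∘tabulate (does ∘ P?) i) (dec-true (P? i) p))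

module _ {n} {_≼_ : Rel (Fin n) 0ℓ} (≼? : Decidable _≼_) where

  ↓ ↑ : Subset n → Subset n
  ↓ = ⟨_⟩ ≼?
  ↑ = ⟩_⟨ ≼?

  ∈↓⁻ : ∀ {X i} → i ∈ₛ ↓ X → ∃ λ j → j ∈ₛ X × i ≼ j
  ∈↓⁻ {X} = ∈-tabulate-does⁻ (λ i → any? (λ j → (j ∈? X) ×-dec ≼? i j))

  ∈↓⁺ : ∀ {X i j} → j ∈ₛ X → i ≼ j → i ∈ₛ ↓ X
  ∈↓⁺ {X} {i} {j} j∈X i≼j = ∈-tabulate-does⁺ (λ i → any? (λ j → (j ∈? X) ×-dec ≼? i j)) (j , j∈X , i≼j)

  ∈↑⁻ : ∀ {X i} → i ∈ₛ ↑ X → ∃ λ j → j ∈ₛ X × j ≼ i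
  ∈↑⁻ {X} = ∈-tabulate-does⁻ (λ i → any? (λ j → (j ∈? X) ×-dec ≼? j i))

  ↓-least : ∀ {X J} → IsIdeal _≼_ J → X ⊆ J → ↓ X ⊆ J
  ↓-least J-ideal X⊆J i∈ with j , j∈X , i≼j ← ∈↓⁻ i∈ = J-ideal _ _ (X⊆J j∈X) i≼j

  ↓-∪ : ∀ X Y → ↓ (X ∪ Y) ⊆ ↓ X ∪ ↓ Y
  ↓-∪ X Y {i} i∈ with j , j∈ , i≼j ← ∈↓⁻ i∈ with x∈p∪q⁻ X Y j∈
  ... | inj₁ j∈X = x∈p∪q⁺ (inj₁ (∈↓⁺ j∈X i≼j))
  ... | inj₂ j∈Y = x∈p∪q⁺ (inj₂ (∈↓⁺ j∈Y i≼j))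

  wP-≤-ideal : ∀ {X J} → IsIdeal _≼_ J → X ⊆ J → wP ≼? X ≤ ∣ J ∣
  wP-≤-ideal J-ideal X⊆J = p⊆q⇒∣p∣≤∣q∣ (↓-least J-ideal X⊆J)

  ↑⁅⁆⊆∁ideal : ∀ {b J} → IsIdeal _≼_ J → b ∉ₛ J → ↑ ⁅ b ⁆ ⊆ ∁ J
  ↑⁅⁆⊆∁ideal {b} {J} J-ideal b∉J i∈ with j , j∈⁅b⁆ , j≼i ← ∈↑⁻ i∈ =
    x∉p⇒x∈∁p λ i∈J → b∉J (subst (_∈ₛ J) (x∈⁅y⁆⇒x≡y b j∈⁅b⁆) (J-ideal _ _ i∈J j≼i))

  -- d = c ⊕ c' is the sum of d ∩ A ⊆ A and d ∩ ∁ A ⊆ B, so c ⊕ (d ∩ A) = c' ⊕ (d ∩ ∁ A)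
  -- are two decompositions of one vector.
  perfect-⊕⊆∪⇒≡ : ∀ {r C A B} → IsPerfect ≼? r C →
    (∀ {X} → X ⊆ A → InBall ≼? r X) → (∀ {X} → X ⊆ B → InBall ≼? r X) →
    ∀ {c c'} → c ∈ₗ C → c' ∈ₗ C → c ⊕ c' ⊆ A ∪ B → c ≡ c'
  perfect-⊕⊆∪⇒≡ {A = A} {B} perfect A-small B-small {c} {c'} c∈C c'∈C d⊆A∪B =
    proj₁ (proj₂ (perfect (c ⊕ (d ∩ A))) c (d ∩ A) c' (d ∩ ∁ A)
      c∈C (A-small (λ {k} k∈ → proj₂ (x∈p∩q⁻ d A k∈))) refl
      c'∈C (B-small d∩∁A⊆B) (⊕-split c c' A))
    where
    d = c ⊕ c'
    d∩∁A⊆B : d ∩ ∁ A ⊆ B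
    d∩∁A⊆B {k} k∈ with k∈d , k∈∁A ← x∈p∩q⁻ d (∁ A) k∈ with x∈p∪q⁻ A B (d⊆A∪B k∈d)
    ... | inj₁ k∈A = ⊥-elim (x∈∁p⇒x∉p k∈∁A k∈A)
    ... | inj₂ k∈B = k∈B

proposition10 : (n : ℕ) (_≼_ : Rel (Fin n) 0ℓ) (po : IsDecPartialOrder _≡_ _≼_) (r : ℕ) →
    r ≤ n → FullTilde _≼_ r →
    (∀ (a : Fin n) → ∣ ∁ (⟨_⟩ (IsDecPartialOrder._≤?_ po) ⁅ a ⁆) ∣ ≥ n ∸ r)
    × (∀ (C : List (Vec Bool n)) (m : ℕ) → Unique C → length C * 2 ^ m ≡ 2 ^ n →
         IsPerfect (IsDecPartialOrder._≤?_ po) r C →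
         ∀ (a a' : Fin n) → ∣ ∁ (⟨_⟩ (IsDecPartialOrder._≤?_ po) (⁅ a ⁆ ∪ ⁅ a' ⁆)) ∣ ≥ (r + (n ∸ r)) ∸ m)
    × (∀ (b : Fin n) → ∣ ⟩_⟨ (IsDecPartialOrder._≤?_ po) ⁅ b ⁆ ∣ ≤ n ∸ r)
proposition10 n _≼_ po r r≤n full = partA , partB , partC
  where
  open IsDecPartialOrder po using (_≤?_) renaming (refl to ≼-refl)

  ⁅⁆⊆ : ∀ {a J} → a ∈ₛ J → ⁅ a ⁆ ⊆ J
  ⁅⁆⊆ {a} {J} a∈J k∈ = subst (_∈ₛ J) (sym (x∈⁅y⁆⇒x≡y a k∈)) a∈J

  ⊆↓⁅⁆⇒InBall : ∀ a {X} → X ⊆ ↓ _≤?_ ⁅ a ⁆ → InBall _≤?_ r X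
  ⊆↓⁅⁆⇒InBall a X⊆ with J , J-ideal , ∣J∣≡r , a∈J ← proj₁ (full a) =
    subst (wP _≤?_ _ ≤_) ∣J∣≡r (wP-≤-ideal _≤?_ J-ideal (↓-least _≤?_ J-ideal (⁅⁆⊆ a∈J) ∘ X⊆))

  partA : ∀ a → ∣ ∁ (↓ _≤?_ ⁅ a ⁆) ∣ ≥ n ∸ r
  partA a = subst (n ∸ r ≤_) (sym (∣∁p∣≡n∸∣p∣ (↓ _≤?_ ⁅ a ⁆)))
    (∸-monoʳ-≤ n (⊆↓⁅⁆⇒InBall a (λ k∈ → ∈↓⁺ _≤?_ k∈ ≼-refl)))

  partB : ∀ C m → Unique C → length C * 2 ^ m ≡ 2 ^ n → IsPerfect _≤?_ r C →
    ∀ a a' → ∣ ∁ (↓ _≤?_ (⁅ a ⁆ ∪ ⁅ a' ⁆)) ∣ ≥ (r + (n ∸ r)) ∸ m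
  partB C m C! ∣C∣ perfect a a' = subst (λ k → k ∸ m ≤ ∣ ∁ I ∣) (sym (m+[n∸m]≡n r≤n))
    (*2^≡2^⇒∸≤ ∣ ∁ I ∣ m ∣C∣≤ ∣C∣)
    where
    I = ↓ _≤?_ (⁅ a ⁆ ∪ ⁅ a' ⁆)
    ∣C∣≤ : length C ≤ 2 ^ ∣ ∁ I ∣
    ∣C∣≤ = length-≤-2^-if-determinedOn (∁ I) C! λ {c} {c'} c∈C c'∈C eq →
      perfect-⊕⊆∪⇒≡ _≤?_ perfect (⊆↓⁅⁆⇒InBall a) (⊆↓⁅⁆⇒InBall a') c∈C c'∈C
        (↓-∪ _≤?_ ⁅ a ⁆ ⁅ a' ⁆ ∘ ∩∁-≡⇒⊕⊆ c c' I eq)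

  partC : ∀ b → ∣ ↑ _≤?_ ⁅ b ⁆ ∣ ≤ n ∸ r
  partC b with J , J-ideal , ∣J∣≡r , b∉J ← proj₂ (full b) =
    subst (∣ ↑ _≤?_ ⁅ b ⁆ ∣ ≤_) (trans (∣∁p∣≡n∸∣p∣ J) (cong (n ∸_) ∣J∣≡r))
      (p⊆q⇒∣p∣≤∣q∣ (↑⁅⁆⊆∁ideal _≤?_ J-ideal b∉J))
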